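{- There is an absolute constant $C>0$ such that for every ordered graph $G$ with interval chromatic number $\chi_i(G)\le 3$ and every integer $n\ge 1$, \[ r_o(G,P_n) \le C\, n\, |V(G)|^2 \log |V(G)| ; \] that is, $r_o(G,P_n) = O(n|V(G)|^2\log|V(G)|)$.
   Context: An ordered graph is a graph with a linear ordering on its vertices; subgraphs inherit the ordering, and copies are taken via order-preserving isomorphisms. The ordered path $P_n$ has vertices $v_1<\dots<v_n$ and edges $v_iv_{i+1}$. The online ordered Ramsey game for ordered graphs $G,H$ is played on vertex set $\mathbb N$ with its usual order: on each turn Builder draws a new edge between two vertices and Painter colors it red or blue; the game ends when there is a red copy of $G$ or a blue copy of $H$. Builder minimizes and Painter maximizes the number of turns; $r_o(G,H)$ is the number of turns under optimal play. An interval coloring of an ordered graph is a proper vertex coloring in which each color class is a set of consecutive vertices; the interval chromatic number $\chi_i(G)$ is the minimum number of colors in an interval coloring of $G$. -}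

module Defs where

open import Data.Nat using (ℕ; zero; suc; _<_; _≤_)
open import Data.Fin using (Fin; toℕ) renaming (_<_ to _<ᶠ_; _≤_ to _≤ᶠ_)
open import Data.Product using (Σ; _×_; _,_)
open import Data.Sum using (_⊎_)
open import Data.List using (List; _∷_; [])
open import Data.List.Membership.Propositional using (_∈_)
open import Relation.Binary.PropositionalEquality using (_≡_; _≢_)
open import Relation.Nullary using (¬_)

-- An ordered graph on vertex set Fin size (ordered as Fin).
-- Edges are stored as pairs i < j with Adj i j.
record OGraph : Set₁ where
  field
    size  : ℕ
    Adj   : Fin size → Fin size → Set
    Adj⇒< : ∀ {i j} → Adj i j → i <ᶠ j
open OGraph public

IsIntervalColoring : (G : OGraph) (c : ℕ) → (Fin (size G) → Fin c) → Set
IsIntervalColoring G c col =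
  (∀ i j → Adj G i j → col i ≢ col j) ×
  (∀ i j k → i ≤ᶠ j → j ≤ᶠ k → col i ≡ col k → col j ≡ col i)

IntervalChromatic≤ : OGraph → ℕ → Set
IntervalChromatic≤ G c = Σ (Fin (size G) → Fin c) (IsIntervalColoring G c)

data _⋖_ {n : ℕ} (i j : Fin n) : Set where
  step : toℕ j ≡ suc (toℕ i) → i ⋖ j

P : ℕ → OGraph
P n = record
  { size = n
  ; Adj = _⋖_
  ; Adj⇒< = λ { (step e) → Data.Nat.Properties.≤-reflexive (Relation.Binary.PropositionalEquality.sym e) }
  }
  where import Data.Nat.Properties
        import Relation.Binary.PropositionalEquality

data Colour : Set where
  red blue : Colour

-- A drawn coloured edge (u , v , c) with u < v.
ColEdge : Set
ColEdge = ℕ × ℕ × Colour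

Board : Set
Board = List ColEdge

HasCopy : OGraph → Colour → Board → Set
HasCopy G c s =
  Σ (Fin (size G) → ℕ) λ f →
    (∀ i j → i <ᶠ j → f i < f j) ×
    (∀ i j → Adj G i j → (f i , f j , c) ∈ s)

GameOver : OGraph → OGraph → Board → Set
GameOver G H s = HasCopy G red s ⊎ HasCopy H blue s

Drawn : ℕ → ℕ → Board → Set
Drawn u v s = Σ Colour λ c → (u , v , c) ∈ s

-- BuilderWithin G H b s : from board s, Builder can force the game to end
-- (red G or blue H) within at most b further turns, whatever Painter does.
BuilderWithin : OGraph → OGraph → ℕ → Board → Set
BuilderWithin G H zero    s = GameOver G H s
BuilderWithin G H (suc b) s =
  GameOver G H s ⊎
  Σ ℕ λ u → Σ ℕ λ v → u < v × ¬ Drawn u v s ×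
    (∀ c → BuilderWithin G H b ((u , v , c) ∷ s))

OnlineOrderedRamsey≤ : OGraph → OGraph → ℕ → Set
OnlineOrderedRamsey≤ G H b = BuilderWithin G H b []

-- Let k = |V(G)|. Builder presents the vertices p = 0, 1, 2, … in turn and joins each new
-- vertex to at most three k-sets. Call the level of a vertex the number of vertices of the
-- longest ascending blue path ending at it: a vertex with a blue edge to a set of level l has
-- level l + 1, and a vertex of level n ends a blue P_n.
--
-- Builder maintains sets X, Y, T of levels a, b, h with a, b ≤ h < n, where Y lies above X
-- and is red-joined to it. The new vertex is scanned against T, then X, then Y; the first
-- blue edge (or its absence) decides which of four buffers receives it, a vertex reaching
-- level h + 1 always going to the first: level h + 1 (a new T),
-- red above T at level a + 1 (a new Y, with T as the new X), red above X at level b + 1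
-- (a new Y), or red above X and Y. A full last buffer is a red blow-up of the ordered
-- triangle with parts of size k, which contains every G with χ_i(G) ≤ 3 since the three
-- colour classes of an interval colouring appear in order. Any other full buffer raises
-- a + b + h < 3n, so at most 3n · 4k vertices are presented, at a cost of at most 3k edges
-- each: r_o(G, P_n) ≤ 36 n k², and ⌊log₂ k⌋ ≥ 1 once G has an edge.

module Submission where

open import Defs
open import Data.Nat as ℕ using (ℕ; zero; suc; _+_; _*_; _^_; _<_; _≤_; z≤n; s≤s; s≤s⁻¹)
open import Data.Nat.Properties
open import Data.Nat.Logarithm using (⌊log₂_⌋; ⌊log₂⌋-mono-≤)
open import Data.Nat.Solver using (module +-*-Solver)
open import Data.Fin as Fin using (Fin; zero; suc; toℕ; fromℕ) renaming (_<_ to _<ᶠ_; _≤_ to _≤ᶠ_)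
open import Data.Fin.Properties using (pigeonhole; ≤fromℕ; toℕ<n) renaming (≤∧≢⇒< to ≤∧≢⇒<ᶠ)
open import Data.Product as Product using (Σ; _×_; _,_; proj₁; proj₂)
open import Data.Product.Properties using (≡-dec)
open import Data.Sum using (_⊎_; inj₁; inj₂)
open import Data.Maybe using (Maybe; just; nothing)
open import Data.Vec using ([]; _∷_; lookup)
open import Data.Empty using (⊥; ⊥-elim)
open import Function using (_∘_)
open import Data.Unit using (⊤; tt)
open import Data.List using ([])
open import Data.List.Membership.Propositional using (_∈_)
open import Data.List.Relation.Unary.Any using (here)
open import Data.List.Relation.Binary.Subset.Propositional using (_⊆_)
open import Data.List.Relation.Binary.Subset.Propositional.Properties using (⊆-refl; ⊆-trans; xs⊆x∷xs)
open import Relation.Binary using (DecidableEquality)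
open import Relation.Binary.PropositionalEquality using (_≡_; _≢_; refl; sym; trans; subst)
open import Relation.Nullary using (Dec; yes; no; contradiction)

Ascending : ℕ → (ℕ → ℕ) → Set
Ascending m e = ∀ i j → i < j → j < m → e i < e j

Every : ℕ → (ℕ → Set) → (ℕ → ℕ) → Set
Every m P e = ∀ i → i < m → P (e i)

Every-suc : ∀ {P m e} → Every m P e → P (e m) → Every (suc m) P e
Every-suc Pe Pm i i<1+m with m≤n⇒m<n∨m≡n (s≤s⁻¹ i<1+m)
... | inj₁ i<m = Pe i i<m
... | inj₂ refl = Pm

Some : ℕ → (ℕ → Set) → (ℕ → ℕ) → Set
Some m P e = Σ ℕ λ i → i < m × P (e i)

extend : (ℕ → ℕ) → ℕ → ℕ → ℕ → ℕ
extend e m v i with i <? m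
... | yes _ = e i
... | no _ = v

extend-< : ∀ {e m v i} → i < m → extend e m v i ≡ e i
extend-< {m = m} {i = i} i<m with i <? m
... | yes _ = refl
... | no i≮m = contradiction i<m i≮m

extend-≡ : ∀ {e m v} → extend e m v m ≡ v
extend-≡ {m = m} with m <? m
... | yes m<m = contradiction m<m (n≮n m)
... | no _ = refl

Every-extend : ∀ {P m e v} → Every m P e → P v → Every (suc m) P (extend e m v)
Every-extend {m = m} Pe Pv i i<1+m with i <? m
... | yes i<m = Pe i i<m
... | no _ = Pv

Ascending-extend : ∀ {m e v} → Ascending m e → Every m (_< v) e → Ascending (suc m) (extend e m v)
Ascending-extend {m} asc below i j i<j j<1+m with i <? m | j <? m
... | yes _ | yes j<m = asc i j i<j j<m
... | yes i<m | no _ = below i i<m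
... | no i≮m | yes j<m = contradiction (<-trans i<j j<m) i≮m
... | no i≮m | no _ = contradiction (<-≤-trans i<j (s≤s⁻¹ j<1+m)) i≮m

third-colour-unique : {a b c d : Fin 3} → a ≢ b → c ≢ a → c ≢ b → d ≢ a → d ≢ b → c ≡ d
third-colour-unique {a} {b} {c} {d} a≢b c≢a c≢b d≢a d≢b
  with pigeonhole (n<1+n 3) (lookup (a ∷ b ∷ c ∷ d ∷ []))
... | zero , suc zero , _ , eq = ⊥-elim (a≢b eq)
... | zero , suc (suc zero) , _ , eq = ⊥-elim (c≢a (sym eq))
... | zero , suc (suc (suc zero)) , _ , eq = ⊥-elim (d≢a (sym eq))
... | suc zero , suc (suc zero) , _ , eq = ⊥-elim (c≢b (sym eq))
... | suc zero , suc (suc (suc zero)) , _ , eq = ⊥-elim (d≢b (sym eq))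
... | suc (suc zero) , suc (suc (suc zero)) , _ , c≡d = c≡d
... | _ , zero , () , _
... | suc zero , suc zero , s≤s () , _
... | suc (suc _) , suc zero , s≤s () , _
... | suc (suc zero) , suc (suc zero) , s≤s (s≤s ()) , _
... | suc (suc (suc zero)) , suc (suc zero) , s≤s (s≤s ()) , _
... | suc (suc (suc zero)) , suc (suc (suc zero)) , s≤s (s≤s (s≤s ())) , _

ConvexClasses : ∀ {k c} → (Fin k → Fin c) → Set
ConvexClasses col = ∀ i j l → i ≤ᶠ j → j ≤ᶠ l → col i ≡ col l → col j ≡ col i

-- The blocks: vertices coloured like the first vertex, like the last vertex, and the rest.
module ThreeBlocks {m} (col : Fin (suc m) → Fin 3) (convex : ConvexClasses col) where

  first last : Fin 3
  first = col zero
  last = col (fromℕ m)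

  data Block (i : Fin (suc m)) : Fin 3 → Set where
    initial : col i ≡ first → Block i zero
    middle : col i ≢ first → col i ≢ last → Block i (suc zero)
    final : col i ≢ first → col i ≡ last → Block i (suc (suc zero))

  block : ∀ i → Σ (Fin 3) (Block i)
  block i with col i Fin.≟ first | col i Fin.≟ last
  ... | yes i₀ | _ = zero , initial i₀
  ... | no ¬i₀ | no ¬i₁ = suc zero , middle ¬i₀ ¬i₁
  ... | no ¬i₀ | yes i₁ = suc (suc zero) , final ¬i₀ i₁

  first-downward : ∀ {i j} → i ≤ᶠ j → col j ≡ first → col i ≡ first
  first-downward {i} {j} i≤j j₀ = convex zero i j z≤n i≤j (sym j₀)

  last-upward : ∀ {i j} → i ≤ᶠ j → col i ≡ last → col j ≡ last
  last-upward {i} {j} i≤j i₁ = trans (convex i j (fromℕ m) i≤j (≤fromℕ j) i₁) i₁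

  Block-mono : ∀ {i j x y} → i ≤ᶠ j → Block i x → Block j y → x ≤ᶠ y
  Block-mono _ (initial _) _ = z≤n
  Block-mono i≤j (middle ¬i₀ _) (initial j₀) = contradiction (first-downward i≤j j₀) ¬i₀
  Block-mono _ (middle _ _) (middle _ _) = ≤-refl
  Block-mono _ (middle _ _) (final _ _) = s≤s z≤n
  Block-mono i≤j (final ¬i₀ _) (initial j₀) = contradiction (first-downward i≤j j₀) ¬i₀
  Block-mono i≤j (final _ i₁) (middle _ ¬j₁) = contradiction (last-upward i≤j i₁) ¬j₁
  Block-mono _ (final _ _) (final _ _) = ≤-refl

  Block-monochromatic : ∀ {i j x} → Block i x → Block j x → col i ≡ col j
  Block-monochromatic (initial i₀) (initial j₀) = trans i₀ (sym j₀)
  Block-monochromatic (final _ i₁) (final _ j₁) = trans i₁ (sym j₁)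
  Block-monochromatic {i} (middle ¬i₀ ¬i₁) (middle ¬j₀ ¬j₁) with first Fin.≟ last
  ... | yes same = contradiction (first-downward (≤fromℕ i) (sym same)) ¬i₀
  ... | no differ = third-colour-unique differ ¬i₀ ¬i₁ ¬j₀ ¬j₁

three-blocks : ∀ {k} (col : Fin k → Fin 3) → ConvexClasses col →
  Σ (Fin k → Fin 3) λ r → (∀ i j → i ≤ᶠ j → r i ≤ᶠ r j) × (∀ i j → r i ≡ r j → col i ≡ col j)
three-blocks {zero} col _ = (λ ()) , (λ ()) , (λ ())
three-blocks {suc m} col convex =
  (λ i → proj₁ (block i)) ,
  (λ i j i≤j → Block-mono i≤j (proj₂ (block i)) (proj₂ (block j))) ,
  (λ i j eq → Block-monochromatic (proj₂ (block i)) (subst (Block j) (sym eq) (proj₂ (block j))))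
  where open ThreeBlocks col convex

RedAbove : Board → ℕ → (ℕ → ℕ) → ℕ → Set
RedAbove s k e v = Every k (λ u → u < v × (u , v , red) ∈ s) e

RedAbove-⊆ : ∀ {s s' k e v} → s ⊆ s' → RedAbove s k e v → RedAbove s' k e v
RedAbove-⊆ s⊆s' reds i i<k = Product.map₂ s⊆s' (reds i i<k)

record RedTriangle (s : Board) (k : ℕ) (X Y Z : ℕ → ℕ) : Set where
  field
    ascendingX : Ascending k X
    ascendingY : Ascending k Y
    ascendingZ : Ascending k Z
    X⇉Y : Every k (RedAbove s k X) Y
    X⇉Z : Every k (RedAbove s k X) Z
    Y⇉Z : Every k (RedAbove s k Y) Z

module _ {s k X Y Z} (△ : RedTriangle s k X Y Z) where
  open RedTriangle △

  side : Fin 3 → ℕ → ℕ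
  side zero = X
  side (suc zero) = Y
  side (suc (suc zero)) = Z

  side-ascending : ∀ x → Ascending k (side x)
  side-ascending zero = ascendingX
  side-ascending (suc zero) = ascendingY
  side-ascending (suc (suc zero)) = ascendingZ

  side-red : ∀ {x y i j} → x <ᶠ y → i < k → j < k →
             side x i < side y j × (side x i , side y j , red) ∈ s
  side-red {zero} {suc zero} _ i<k j<k = X⇉Y _ j<k _ i<k
  side-red {zero} {suc (suc zero)} _ i<k j<k = X⇉Z _ j<k _ i<k
  side-red {suc zero} {suc (suc zero)} _ i<k j<k = Y⇉Z _ j<k _ i<k
  side-red {_} {zero} ()
  side-red {suc zero} {suc zero} (s≤s ())
  side-red {suc (suc zero)} {suc zero} (s≤s ())
  side-red {suc (suc zero)} {suc (suc zero)} (s≤s (s≤s ()))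

RedTriangle⇒copy : (G : OGraph) → IntervalChromatic≤ G 3 →
                   ∀ {s X Y Z} → RedTriangle s (size G) X Y Z → HasCopy G red s
RedTriangle⇒copy G (col , proper , convex) {s} △ = f , f-ascending , f-red
  where
  r = proj₁ (three-blocks col convex)
  r-mono = proj₁ (proj₂ (three-blocks col convex))
  r-fibre = proj₂ (proj₂ (three-blocks col convex))

  f : Fin (size G) → ℕ
  f i = side △ (r i) (toℕ i)

  f-ascending : ∀ i j → i <ᶠ j → f i < f j
  f-ascending i j i<j with r i Fin.≟ r j
  ... | yes ri≡rj rewrite ri≡rj = side-ascending △ (r j) _ _ i<j (toℕ<n j)
  ... | no ri≢rj = proj₁ (side-red △ (≤∧≢⇒<ᶠ (r-mono i j (<⇒≤ i<j)) ri≢rj) (toℕ<n i) (toℕ<n j))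

  f-red : ∀ i j → Adj G i j → (f i , f j , red) ∈ s
  f-red i j ij = proj₂ (side-red △ ri<rj (toℕ<n i) (toℕ<n j))
    where ri<rj = ≤∧≢⇒<ᶠ (r-mono i j (<⇒≤ (Adj⇒< G ij))) (λ eq → proper i j ij (r-fibre i j eq))

edgeless⇒copy : ∀ {c s} (G : OGraph) → size G ≤ 1 → HasCopy G c s
edgeless⇒copy G size≤1 = toℕ , (λ _ _ i<j → i<j) , λ i j ij →
  contradiction (<-≤-trans (Adj⇒< G ij) (s≤s⁻¹ (≤-trans (toℕ<n j) size≤1))) n≮0

record BluePath (s : Board) (m v : ℕ) : Set where
  field
    vertex : ℕ → ℕ
    ends : vertex m ≡ v
    link : ∀ i → i < m → vertex i < vertex (suc i) × (vertex i , vertex (suc i) , blue) ∈ s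
open BluePath

Level : Board → ℕ → ℕ → Set
Level s l v = Σ ℕ λ m → l ≤ suc m × BluePath s m v

Level-one : ∀ {s v} → Level s 1 v
Level-one {v = v} = 0 , ≤-refl , record { vertex = λ _ → v ; ends = refl ; link = λ _ () }

Level-≤ : ∀ {s l l' v} → l' ≤ l → Level s l v → Level s l' v
Level-≤ l'≤l (m , l≤ , π) = m , ≤-trans l'≤l l≤ , π

Level-⊆ : ∀ {s s' l v} → s ⊆ s' → Level s l v → Level s' l v
Level-⊆ s⊆s' (m , l≤ , π) = m , l≤ , record
  { vertex = vertex π ; ends = ends π ; link = λ i i<m → Product.map₂ s⊆s' (link π i i<m) }

Level-extend : ∀ {s l u v} → Level s l u → u < v → (u , v , blue) ∈ s → Level s (suc l) v
Level-extend {s} {l} {u} {v} (m , l≤ , π) u<v uv = suc m , s≤s l≤ , record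
  { vertex = vertex′ ; ends = extend-≡ {vertex π} {suc m} ; link = link′ }
  where
  vertex′ = extend (vertex π) (suc m) v
  old : ∀ {i} → i < suc m → vertex′ i ≡ vertex π i
  old = extend-<
  link′ : ∀ i → i < suc m → vertex′ i < vertex′ (suc i) × (vertex′ i , vertex′ (suc i) , blue) ∈ s
  link′ i i<1+m with m≤n⇒m<n∨m≡n (s≤s⁻¹ i<1+m)
  ... | inj₁ i<m rewrite old (m<n⇒m<1+n i<m) | old (s≤s i<m) = link π i i<m
  ... | inj₂ refl rewrite old i<1+m | extend-≡ {vertex π} {suc i} {v} | ends π = u<v , uv

BluePath-ascending : ∀ {s m v} (π : BluePath s m v) → ∀ i j → i < j → j ≤ m → vertex π i < vertex π j
BluePath-ascending π i (suc j) i<1+j 1+j≤m with m≤n⇒m<n∨m≡n (s≤s⁻¹ i<1+j)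
... | inj₁ i<j = <-trans (BluePath-ascending π i j i<j (<⇒≤ 1+j≤m)) (proj₁ (link π j 1+j≤m))
... | inj₂ refl = proj₁ (link π i 1+j≤m)

Level⇒copy : ∀ {s n v} → Level s n v → HasCopy (P n) blue s
Level⇒copy {s} {n} (m , n≤1+m , π) = f , f-ascending , f-blue
  where
  f : Fin n → ℕ
  f i = vertex π (toℕ i)
  below-m : ∀ (i : Fin n) → toℕ i ≤ m
  below-m i = s≤s⁻¹ (<-≤-trans (toℕ<n i) n≤1+m)
  f-ascending : ∀ i j → i <ᶠ j → f i < f j
  f-ascending i j i<j = BluePath-ascending π (toℕ i) (toℕ j) i<j (below-m j)
  f-blue : ∀ i j → i ⋖ j → (f i , f j , blue) ∈ s
  f-blue i j (step j≡1+i) rewrite j≡1+i = proj₂ (link π (toℕ i) (subst (_≤ m) j≡1+i (below-m j)))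

record IsBatch (P : ℕ → Set) (p m : ℕ) (e : ℕ → ℕ) : Set where
  field
    ascending : Ascending m e
    bounded : Every m (_< p) e
    satisfies : Every m P e
open IsBatch

Batch : (ℕ → Set) → ℕ → ℕ → Set
Batch P p m = Σ (ℕ → ℕ) (IsBatch P p m)

IsBatch-map : ∀ {P Q : ℕ → Set} {p q m e} → (∀ {v} → P v → Q v) → p ≤ q → IsBatch P p m e → IsBatch Q q m e
IsBatch-map P⇒Q p≤q B = record
  { ascending = ascending B
  ; bounded = λ i i<m → <-≤-trans (bounded B i i<m) p≤q
  ; satisfies = λ i i<m → P⇒Q (satisfies B i i<m) }

Batch-empty : ∀ {P p} → Batch P p 0
Batch-empty = (λ _ → 0) , record { ascending = λ _ _ _ () ; bounded = λ _ () ; satisfies = λ _ () }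

Batch-snoc : ∀ {P p m} → Batch P p m → P p → Batch P (suc p) (suc m)
Batch-snoc {P} {p} {m} (e , B) Pp = extend e m p , record
  { ascending = Ascending-extend (ascending B) (bounded B)
  ; bounded = Every-extend {_< suc p} (λ i i<m → m<n⇒m<1+n (bounded B i i<m)) ≤-refl
  ; satisfies = Every-extend {P} (satisfies B) Pp }

Buffer : ℕ → (ℕ → Set) → ℕ → Set
Buffer k P p = Σ ℕ λ m → m < k × Batch P p m

count : ∀ {k P p} → Buffer k P p → ℕ
count = proj₁

count<k : ∀ {k P p} (B : Buffer k P p) → count B < k
count<k = proj₁ ∘ proj₂

Buffer-empty : ∀ {k P p} → 0 < k → Buffer k P p
Buffer-empty 0<k = 0 , 0<k , Batch-empty

Buffer-map : ∀ {k} {P Q : ℕ → Set} {p q} → (∀ {v} → P v → Q v) → p ≤ q → Buffer k P p → Buffer k Q q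
Buffer-map P⇒Q p≤q (m , m<k , e , B) = m , m<k , e , IsBatch-map P⇒Q p≤q B

push : ∀ {k P p} (B : Buffer k P p) → P p →
       (suc (count B) < k × Batch P (suc p) (suc (count B))) ⊎ Batch P (suc p) k
push {k} (m , m<k , B) Pp with suc m <? k
... | yes 1+m<k = inj₁ (1+m<k , Batch-snoc B Pp)
... | no 1+m≮k = inj₂ (subst (Batch _ _) (≤∧≮⇒≡ m<k 1+m≮k) (Batch-snoc B Pp))

_≟ᶜ_ : DecidableEquality Colour
red ≟ᶜ red = yes refl
red ≟ᶜ blue = no λ ()
blue ≟ᶜ red = no λ ()
blue ≟ᶜ blue = yes refl

open import Data.List.Membership.DecPropositional (≡-dec ℕ._≟_ (≡-dec ℕ._≟_ _≟ᶜ_)) using (_∈?_)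

Drawn? : ∀ u v s → Dec (Drawn u v s)
Drawn? u v s with (u , v , red) ∈? s | (u , v , blue) ∈? s
... | yes r | _ = yes (red , r)
... | no _ | yes b = yes (blue , b)
... | no ¬r | no ¬b = no λ { (red , r) → ¬r r ; (blue , b) → ¬b b }

module Game (G H : OGraph) where

  Within : ℕ → Board → Set
  Within = BuilderWithin G H

  Within-mono : ∀ {b b' s} → b ≤ b' → Within b s → Within b' s
  Within-mono {zero} {zero} _ w = w
  Within-mono {zero} {suc _} _ over = inj₁ over
  Within-mono {suc _} {suc _} _ (inj₁ over) = inj₁ over
  Within-mono {suc _} {suc _} (s≤s b≤b') (inj₂ (u , v , u<v , fresh , next)) =
    inj₂ (u , v , u<v , fresh , λ c → Within-mono b≤b' (next c))

  GameOver⇒Within : ∀ {b s} → GameOver G H s → Within b s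
  GameOver⇒Within {zero} over = over
  GameOver⇒Within {suc _} over = inj₁ over

  -- An edge that is already drawn is reused at no cost.
  draw : ∀ {b s u v} → u < v → (∀ c {s'} → s ⊆ s' → (u , v , c) ∈ s' → Within b s') → Within (suc b) s
  draw {s = s} {u} {v} u<v next with Drawn? u v s
  ... | yes (c , uv) = Within-mono (n≤1+n _) (next c ⊆-refl uv)
  ... | no fresh = inj₂ (u , v , u<v , fresh , λ c → next c (xs⊆x∷xs s _) (here refl))

  drawStar : ∀ {b s} e p j → Every j (_< p) e →
    (∀ {s'} → s ⊆ s' → Every j (λ u → (u , p , red) ∈ s') e ⊎ Some j (λ u → (u , p , blue) ∈ s') e → Within b s') →
    Within (j + b) s
  drawStar e p zero _ next = next ⊆-refl (inj₁ λ _ ())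
  drawStar {b} e p (suc j) below next = draw (below j ≤-refl) λ where
    red s⊆s' red-j → drawStar e p j (λ i i<j → below i (m<n⇒m<1+n i<j)) λ where
      s'⊆s'' (inj₁ reds) → next (⊆-trans s⊆s' s'⊆s'') (inj₁ (Every-suc {λ u → (u , p , red) ∈ _} reds (s'⊆s'' red-j)))
      s'⊆s'' (inj₂ (i , i<j , blue-i)) → next (⊆-trans s⊆s' s'⊆s'') (inj₂ (i , m<n⇒m<1+n i<j , blue-i))
    blue s⊆s' blue-j → Within-mono (m≤n+m b j) (next s⊆s' (inj₂ (j , ≤-refl , blue-j)))

lex-< : ∀ {x y f w} → x < y → f < w → x * w + f < y * w
lex-< {x} {y} {f} {w} x<y f<w = begin-strict
  x * w + f <⟨ +-monoʳ-< (x * w) f<w ⟩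
  x * w + w ≡⟨ +-comm (x * w) w ⟩
  suc x * w ≤⟨ *-monoˡ-≤ w x<y ⟩
  y * w ∎
  where open ≤-Reasoning

module Strategy (G : OGraph) {k} (0<k : 0 < k)
                (embeds : ∀ {s X Y Z} → RedTriangle s k X Y Z → HasCopy G red s)
                (n : ℕ) where
  open Game G (P n)

  -- nothing is the virtual level-0 set: scanning it draws no edge and puts the new vertex
  -- at level 1.
  LevelSet : Board → ℕ → ℕ → Maybe (ℕ → ℕ) → Set
  LevelSet s p l nothing = l ≡ 0
  LevelSet s p l (just e) = IsBatch (Level s l) p k e

  RedAboveᵖ : Maybe (ℕ → ℕ) → Board → ℕ → Set
  RedAboveᵖ nothing s v = ⊥
  RedAboveᵖ (just e) s v = RedAbove s k e v

  Joined : Board → Maybe (ℕ → ℕ) → Maybe (ℕ → ℕ) → Set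
  Joined s X nothing = ⊤
  Joined s X (just e) = Every k (RedAboveᵖ X s) e

  LevelSet-⊆ : ∀ {s s' p p' l} X → s ⊆ s' → p ≤ p' → LevelSet s p l X → LevelSet s' p' l X
  LevelSet-⊆ nothing _ _ l≡0 = l≡0
  LevelSet-⊆ (just e) s⊆s' p≤p' L = IsBatch-map (Level-⊆ s⊆s') p≤p' L

  RedAboveᵖ-⊆ : ∀ {s s' v} X → s ⊆ s' → RedAboveᵖ X s v → RedAboveᵖ X s' v
  RedAboveᵖ-⊆ (just e) s⊆s' = RedAbove-⊆ s⊆s'

  Joined-⊆ : ∀ {s s'} X Y → s ⊆ s' → Joined s X Y → Joined s' X Y
  Joined-⊆ X nothing _ _ = tt
  Joined-⊆ X (just e) s⊆s' J j j<k = RedAboveᵖ-⊆ X s⊆s' (J j j<k)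

  scan : ∀ {β s p l} X → LevelSet s p l X →
         (∀ {s'} → s ⊆ s' → RedAboveᵖ X s' p ⊎ Level s' (suc l) p → Within β s') → Within (k + β) s
  scan nothing refl next = Within-mono (m≤n+m _ k) (next ⊆-refl (inj₂ Level-one))
  scan {p = p} (just e) L next = drawStar e p k (bounded L) λ where
    s⊆s' (inj₁ reds) → next s⊆s' (inj₁ λ i i<k → bounded L i i<k , reds i i<k)
    s⊆s' (inj₂ (i , i<k , blue-i)) →
      next s⊆s' (inj₂ (Level-extend (Level-⊆ s⊆s' (satisfies L i i<k)) (bounded L i i<k) blue-i))

  record State (s : Board) (p : ℕ) : Set where
    field
      a b h : ℕ
      X Y T : Maybe (ℕ → ℕ)
      X-level : LevelSet s p a X
      Y-level : LevelSet s p b Y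
      T-level : LevelSet s p h T
      X⇉Y : Joined s X Y
      Zs : Buffer k (λ v → RedAboveᵖ X s v × RedAboveᵖ Y s v) p
      Ys : Buffer k (λ v → RedAboveᵖ X s v × Level s (suc b) v) p
      Ts : Buffer k (Level s (suc h)) p
      Bs : Buffer k (λ v → RedAboveᵖ T s v × Level s (suc a) v) p
      a≤h : a ≤ h
      b≤h : b ≤ h
      h<n : h < n
  open State

  State-⊆ : ∀ {s s' p p'} → s ⊆ s' → p ≤ p' → State s p → State s' p'
  State-⊆ s⊆s' p≤ st = record
    { a = a st ; b = b st ; h = h st ; X = X st ; Y = Y st ; T = T st
    ; X-level = LevelSet-⊆ (X st) s⊆s' p≤ (X-level st)
    ; Y-level = LevelSet-⊆ (Y st) s⊆s' p≤ (Y-level st)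
    ; T-level = LevelSet-⊆ (T st) s⊆s' p≤ (T-level st)
    ; X⇉Y = Joined-⊆ (X st) (Y st) s⊆s' (X⇉Y st)
    ; Zs = Buffer-map (Product.map (RedAboveᵖ-⊆ (X st) s⊆s') (RedAboveᵖ-⊆ (Y st) s⊆s')) p≤ (Zs st)
    ; Ys = Buffer-map (Product.map (RedAboveᵖ-⊆ (X st) s⊆s') (Level-⊆ s⊆s')) p≤ (Ys st)
    ; Ts = Buffer-map (Level-⊆ s⊆s') p≤ (Ts st)
    ; Bs = Buffer-map (Product.map (RedAboveᵖ-⊆ (T st) s⊆s') (Level-⊆ s⊆s')) p≤ (Bs st)
    ; a≤h = a≤h st ; b≤h = b≤h st ; h<n = h<n st }

  height fill : ∀ {s p} → State s p → ℕ
  height st = a st + b st + h st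
  fill st = count (Zs st) + count (Ys st) + count (Ts st) + count (Bs st)

  width bound : ℕ
  width = k + k + k + k
  bound = (n + n + n) * width

  Ψ : ∀ {s p} → State s p → ℕ
  Ψ st = height st * width + fill st

  height< : ∀ {s p} (st : State s p) → height st < n + n + n
  height< st = +-mono-≤ (+-mono-≤ (≤-<-trans (a≤h st) (h<n st)) (≤-trans (b≤h st) (<⇒≤ (h<n st)))) (<⇒≤ (h<n st))

  fill< : ∀ {s p} (st : State s p) → fill st < width
  fill< st = +-mono-≤ (+-mono-≤ (+-mono-≤ (count<k (Zs st)) (<⇒≤ (count<k (Ys st))))
                                  (<⇒≤ (count<k (Ts st)))) (<⇒≤ (count<k (Bs st)))

  Ψ<bound : ∀ {s p} (st : State s p) → Ψ st < bound
  Ψ<bound st = lex-< (height< st) (fill< st)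

  Ψ-height : ∀ {s p s' p'} (st : State s p) (st' : State s' p') → height st < height st' → Ψ st < Ψ st'
  Ψ-height st st' lt = <-≤-trans (lex-< lt (fill< st)) (m≤m+n _ (fill st'))

  Ψ-fill : ∀ {s p s' p'} (st : State s p) (st' : State s' p') → height st ≡ height st' → fill st < fill st' → Ψ st < Ψ st'
  Ψ-fill st st' same lt = subst (λ x → Ψ st < x * width + fill st') same (+-monoʳ-< (height st * width) lt)

  Next : ∀ {s p} → State s p → ℕ → Set
  Next {s} {p} st β = ∀ {s'} → s ⊆ s' → (st' : State s' (suc p)) → Ψ st < Ψ st' → Within β s'

  full-Z⇒copy : ∀ {s₀ p₀ a b s q e} X Y → LevelSet s₀ p₀ a X → LevelSet s₀ p₀ b Y → Joined s X Y →
                IsBatch (λ v → RedAboveᵖ X s v × RedAboveᵖ Y s v) q k e → HasCopy G red s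
  full-Z⇒copy nothing Y _ _ _ Z = ⊥-elim (proj₁ (satisfies Z 0 0<k))
  full-Z⇒copy (just _) nothing _ _ _ Z = ⊥-elim (proj₂ (satisfies Z 0 0<k))
  full-Z⇒copy (just _) (just _) LX LY X⇉Y Z = embeds record
    { ascendingX = ascending LX ; ascendingY = ascending LY ; ascendingZ = ascending Z
    ; X⇉Y = X⇉Y
    ; X⇉Z = λ j j<k → proj₁ (satisfies Z j j<k)
    ; Y⇉Z = λ j j<k → proj₂ (satisfies Z j j<k) }

  module _ {β s p} (st : State s p) (next : Next st β) {s'} (s⊆s' : s ⊆ s') where
    -- st₀ still lives at time p, so that p can be pushed into its buffers.
    private
      st₀ = State-⊆ s⊆s' ≤-refl st
      st₁ = State-⊆ s⊆s' (n≤1+n p) st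
      cZ = count (Zs st)
      cY = count (Ys st)
      cT = count (Ts st)
      cB = count (Bs st)

    addZ : RedAboveᵖ (X st) s' p → RedAboveᵖ (Y st) s' p → Within β s'
    addZ rX rY with push (Zs st₀) (rX , rY)
    ... | inj₁ (lt , B) = next s⊆s' st' (Ψ-fill st st' refl ≤-refl)
      where st' = record st₁ { Zs = _ , lt , B }
    ... | inj₂ (e , Z) = GameOver⇒Within (inj₁ (full-Z⇒copy (X st) (Y st) (X-level st) (Y-level st) (X⇉Y st₀) Z))

    addY : b st < h st → RedAboveᵖ (X st) s' p → Level s' (suc (b st)) p → Within β s'
    addY b<h rX lv with push (Ys st₀) (rX , lv)
    ... | inj₁ (lt , B) = next s⊆s' st' (Ψ-fill st st' refl (+-monoˡ-< cB (+-monoˡ-< cT (+-monoʳ-< cZ ≤-refl))))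
      where st' = record st₁ { Ys = _ , lt , B }
    ... | inj₂ (e , B) = next s⊆s' st' (Ψ-height st st' (+-monoˡ-< (h st) (+-monoʳ-< (a st) ≤-refl)))
      where
      st' = record st₁
        { b = suc (b st) ; Y = just e
        ; Y-level = IsBatch-map proj₂ ≤-refl B ; X⇉Y = λ j j<k → proj₁ (satisfies B j j<k)
        ; Zs = Buffer-empty 0<k ; Ys = Buffer-empty 0<k ; b≤h = b<h }

    addT : Level s' (suc (h st)) p → Within β s'
    addT lv with suc (h st) <? n
    ... | no 1+h≮n = GameOver⇒Within (inj₂ (Level⇒copy (Level-≤ (≮⇒≥ 1+h≮n) lv)))
    ... | yes 1+h<n with push (Ts st₀) lv
    ...   | inj₁ (lt , B) = next s⊆s' st' (Ψ-fill st st' refl (+-monoˡ-< cB (+-monoʳ-< (cZ + cY) ≤-refl)))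
      where st' = record st₁ { Ts = _ , lt , B }
    ...   | inj₂ (e , B) = next s⊆s' st' (Ψ-height st st' (+-monoʳ-< (a st + b st) ≤-refl))
      where
      st' = record st₁
        { h = suc (h st) ; T = just e ; T-level = B
        ; Ts = Buffer-empty 0<k ; Bs = Buffer-empty 0<k
        ; a≤h = m≤n⇒m≤1+n (a≤h st) ; b≤h = m≤n⇒m≤1+n (b≤h st) ; h<n = 1+h<n }

    addB : a st < h st → RedAboveᵖ (T st) s' p → Level s' (suc (a st)) p → Within β s'
    addB a<h rT lv with push (Bs st₀) (rT , lv)
    ... | inj₁ (lt , B) = next s⊆s' st' (Ψ-fill st st' refl (+-monoʳ-< (cZ + cY + cT) ≤-refl))
      where st' = record st₁ { Bs = _ , lt , B }
    ... | inj₂ (e , B) = next s⊆s' st' (Ψ-height st st' (+-monoˡ-< (h st) a+b<h+1+a))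
      where
      st' = record st₁
        { a = h st ; b = suc (a st) ; X = T st ; Y = just e
        ; X-level = T-level st₁ ; Y-level = IsBatch-map proj₂ ≤-refl B
        ; X⇉Y = λ j j<k → proj₁ (satisfies B j j<k)
        ; Zs = Buffer-empty 0<k ; Ys = Buffer-empty 0<k ; Bs = Buffer-empty 0<k
        ; a≤h = ≤-refl ; b≤h = a<h }
      a+b<h+1+a : a st + b st < h st + suc (a st)
      a+b<h+1+a = ≤-trans (s≤s (+-monoʳ-≤ (a st) (b≤h st))) (≤-reflexive (+-comm (suc (a st)) (h st)))

    blue-to-X : RedAboveᵖ (T st) s' p → Level s' (suc (a st)) p → Within β s'
    blue-to-X rT lv with a st <? h st
    ... | yes a<h = addB a<h rT lv
    ... | no a≮h = addT (Level-≤ (s≤s (≮⇒≥ a≮h)) lv)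

    blue-to-Y : RedAboveᵖ (X st) s' p → Level s' (suc (b st)) p → Within β s'
    blue-to-Y rX lv with b st <? h st
    ... | yes b<h = addY b<h rX lv
    ... | no b≮h = addT (Level-≤ (s≤s (≮⇒≥ b≮h)) lv)

  red-above-X : ∀ {β s p} (st : State s p) → Next st β → ∀ {s'} → s ⊆ s' → RedAboveᵖ (X st) s' p → Within (k + β) s'
  red-above-X st next s⊆s₁ rX = scan (Y st) (LevelSet-⊆ (Y st) s⊆s₁ ≤-refl (Y-level st)) λ where
    s₁⊆s₂ (inj₁ rY) → addZ st next (⊆-trans s⊆s₁ s₁⊆s₂) (RedAboveᵖ-⊆ (X st) s₁⊆s₂ rX) rY
    s₁⊆s₂ (inj₂ lv) → blue-to-Y st next (⊆-trans s⊆s₁ s₁⊆s₂) (RedAboveᵖ-⊆ (X st) s₁⊆s₂ rX) lv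

  delay : ∀ {β s} → Within β s → Within (k + β) s
  delay = Within-mono (m≤n+m _ k)

  round : ∀ {β s p} (st : State s p) → Next st β → Within (k + (k + (k + β))) s
  round st next = scan (T st) (T-level st) λ where
    s⊆s₁ (inj₂ lv) → delay (delay (addT st next s⊆s₁ lv))
    s⊆s₁ (inj₁ rT) → scan (X st) (LevelSet-⊆ (X st) s⊆s₁ ≤-refl (X-level st)) λ where
      s₁⊆s₂ (inj₂ lv) → delay (blue-to-X st next (⊆-trans s⊆s₁ s₁⊆s₂) (RedAboveᵖ-⊆ (T st) s₁⊆s₂ rT) lv)
      s₁⊆s₂ (inj₁ rX) → red-above-X st next (⊆-trans s⊆s₁ s₁⊆s₂) rX

  run : ∀ F {s p} (st : State s p) → bound ≤ F + Ψ st → Within (F * (k + k + k)) s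
  run zero st bound≤Ψ = contradiction bound≤Ψ (<⇒≱ (Ψ<bound st))
  run (suc F) st bound≤ = Within-mono (≤-reflexive round-cost) (round st λ _ st' Ψ< →
    run F st' (≤-trans bound≤ (≤-trans (≤-reflexive (sym (+-suc F (Ψ st)))) (+-monoʳ-≤ F Ψ<))))
    where
    x = F * (k + k + k)
    round-cost : k + (k + (k + x)) ≡ k + k + k + x
    round-cost = sym (trans (+-assoc (k + k) k x) (+-assoc k k (k + x)))

  initial : 1 ≤ n → State [] 0
  initial 1≤n = record
    { a = 0 ; b = 0 ; h = 0 ; X = nothing ; Y = nothing ; T = nothing
    ; X-level = refl ; Y-level = refl ; T-level = refl ; X⇉Y = tt
    ; Zs = Buffer-empty 0<k ; Ys = Buffer-empty 0<k ; Ts = Buffer-empty 0<k ; Bs = Buffer-empty 0<k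
    ; a≤h = z≤n ; b≤h = z≤n ; h<n = 1≤n }

  builder-wins : 1 ≤ n → Within (bound * (k + k + k)) []
  builder-wins 1≤n = run bound (initial 1≤n) (m≤m+n bound 0)

cost≤ : ∀ n k → 2 ≤ k → (n + n + n) * (k + k + k + k) * (k + k + k) ≤ 36 * n * k ^ 2 * ⌊log₂ k ⌋
cost≤ n k 2≤k = begin
  (n + n + n) * (k + k + k + k) * (k + k + k) ≡⟨ solve 2 (λ n k → (n :+ n :+ n) :* (k :+ k :+ k :+ k) :* (k :+ k :+ k) := con 36 :* n :* (k :^ 2)) refl n k ⟩
  36 * n * k ^ 2                              ≡⟨ *-identityʳ _ ⟨
  36 * n * k ^ 2 * 1                          ≤⟨ *-monoʳ-≤ (36 * n * k ^ 2) (⌊log₂⌋-mono-≤ 2≤k) ⟩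
  36 * n * k ^ 2 * ⌊log₂ k ⌋                  ∎
  where open ≤-Reasoning
        open +-*-Solver

theorem1p2 : Σ ℕ λ C → 0 < C ×
    ((G : OGraph) → IntervalChromatic≤ G 3 → (n : ℕ) → 1 ≤ n →
    OnlineOrderedRamsey≤ G (P n) (C * n * (size G ^ 2) * ⌊log₂ size G ⌋))
theorem1p2 = 36 , s≤s z≤n , builder
  where
  builder : (G : OGraph) → IntervalChromatic≤ G 3 → (n : ℕ) → 1 ≤ n →
            OnlineOrderedRamsey≤ G (P n) (36 * n * (size G ^ 2) * ⌊log₂ size G ⌋)
  builder G χ n 1≤n with size G ≤? 1
  ... | yes size≤1 = Game.GameOver⇒Within G (P n) (inj₁ (edgeless⇒copy G size≤1))
  ... | no size≰1 = Game.Within-mono G (P n) (cost≤ n (size G) 2≤k) (Strategy.builder-wins G 0<k (RedTriangle⇒copy G χ) n 1≤n)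
    where
    2≤k = ≰⇒> size≰1
    0<k = <-trans (s≤s z≤n) 2≤k
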